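{- For every finite poset $L$, $\mathcal S(h_L)$ is a sub-Heyting algebra of the Heyting algebra $Sub(h_L)$ of all subpresheaves of $h_L$.
   Context: $\mathbf P_0$: category of finite posets with a greatest element (root $\rho(P)$) and open (p-)morphisms $h:Q\to P$ (order-preserving, and whenever $p'\le h(q)$ there is $q'\le q$ with $h(q')=p'$). $\downarrow p=\{p'\le p\}$. For a finite poset $L$, $h_L$ is the presheaf on $\mathbf P_0$ with $h_L(P)$ the order-preserving maps $u:P\to L$ and restriction $u\mapsto u\circ h$; $u_p$ is the restriction of $u$ to $\downarrow p$. $u\sim_0 v$ iff $u(\rho(P))=v(\rho(Q))$; $u\sim_{n+1}v$ iff every $p\in P$ has $q\in Q$ with $u_p\sim_n v_q$ and every $q\in Q$ has $p\in P$ with $u_p\sim_n v_q$. A subpresheaf $S\subseteq h_L$ has b-index $n$ if for all $u\in S_P$ and $v:Q\to L$ with $u\sim_n v$ we have $v\in S_Q$. $\mathcal S(h_L)$ is the set of subpresheaves of $h_L$ having some b-index. $Sub(h_L)$ is the Heyting algebra of subpresheaves with intersection, union, and $(S\to T)_P=\{u\mid \forall h:Q\to P\,(u\circ h\in S_Q\Rightarrow u\circ h\in T_Q)\}$. -}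

module Defs where

open import Level using (Level; 0ℓ; Lift) renaming (suc to lsuc)
open import Data.Nat using (ℕ; zero; suc)
open import Data.Fin using (Fin)
open import Data.Empty using (⊥)
open import Data.Unit using (⊤)
open import Data.Product using (Σ; ∃; ∃-syntax; _×_; _,_)
open import Data.Sum using (_⊎_)
open import Relation.Binary using (Rel)
open import Relation.Binary.Structures using (IsDecPartialOrder)
open import Relation.Binary.PropositionalEquality using (_≡_)

record FinPoset : Set₁ where
  field
    size : ℕ
    _≤_ : Rel (Fin size) 0ℓ
    isDecPartialOrder : IsDecPartialOrder _≡_ _≤_

  Carrier : Set
  Carrier = Fin size

open FinPoset public using (Carrier)

record RootedFinPoset : Set₁ where
  field
    poset : FinPoset
    root : Carrier poset
    root-greatest : ∀ p → FinPoset._≤_ poset p root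

  open FinPoset poset public

record Mono (P L : FinPoset) : Set where
  private
    module P = FinPoset P
    module L = FinPoset L
  field
    fun : P.Carrier → L.Carrier
    mono : ∀ {x y} → x P.≤ y → fun x L.≤ fun y

open Mono public

record PMor (Q P : RootedFinPoset) : Set where
  private
    module Q = RootedFinPoset Q
    module P = RootedFinPoset P
  field
    pfun : Q.Carrier → P.Carrier
    pmono : ∀ {x y} → x Q.≤ y → pfun x P.≤ pfun y
    open-map : ∀ q p' → p' P.≤ pfun q → ∃[ q' ] (q' Q.≤ q × pfun q' ≡ p')

open PMor public

HL : FinPoset → RootedFinPoset → Set
HL L P = Mono (RootedFinPoset.poset P) L

restrict : ∀ {L Q P} → HL L P → PMor Q P → HL L Q
restrict u h = record
  { fun = λ q → fun u (pfun h q)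
  ; mono = λ q≤q' → mono u (pmono h q≤q') }

PredL : FinPoset → Set₂
PredL L = (P : RootedFinPoset) → HL L P → Set₁

IsSubpresheaf : ∀ {L} → PredL L → Set₁
IsSubpresheaf {L} S =
  ∀ {Q P : RootedFinPoset} (h : PMor Q P) (u : HL L P) → S P u → S Q (restrict u h)

-- Bisimulation relation ∼ₙ on pointed maps: (u , p) ∼ₙ (v , q) means u_p ∼ₙ v_q,
-- where u_p is the restriction of u to ↓p (whose root is p).
Bisim : ∀ {L} → ℕ → (P : RootedFinPoset) → HL L P → RootedFinPoset.Carrier P
      → (Q : RootedFinPoset) → HL L Q → RootedFinPoset.Carrier Q → Set
Bisim zero P u p Q v q = fun u p ≡ fun v q
Bisim (suc n) P u p Q v q =
  (∀ p' → RootedFinPoset._≤_ P p' p →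
     ∃[ q' ] (RootedFinPoset._≤_ Q q' q × Bisim n P u p' Q v q'))
  × (∀ q' → RootedFinPoset._≤_ Q q' q →
     ∃[ p' ] (RootedFinPoset._≤_ P p' p × Bisim n P u p' Q v q'))

_∼[_]_ : ∀ {L} {P Q : RootedFinPoset} → HL L P → ℕ → HL L Q → Set
_∼[_]_ {L} {P} {Q} u n v =
  Bisim {L} n P u (RootedFinPoset.root P) Q v (RootedFinPoset.root Q)

HasBIndex : ∀ {L} → PredL L → ℕ → Set₁
HasBIndex {L} S n = ∀ (P Q : RootedFinPoset) (u : HL L P) (v : HL L Q) →
  S P u → _∼[_]_ {L} {P} {Q} u n v → S Q v

In𝒮 : ∀ {L} → PredL L → Set₁
In𝒮 S = IsSubpresheaf S × Σ ℕ (λ n → HasBIndex S n)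

botS : ∀ {L} → PredL L
botS _ _ = Lift _ ⊥

topS : ∀ {L} → PredL L
topS _ _ = Lift _ ⊤

_∩S_ : ∀ {L} → PredL L → PredL L → PredL L
(S ∩S T) P u = S P u × T P u

_∪S_ : ∀ {L} → PredL L → PredL L → PredL L
(S ∪S T) P u = S P u ⊎ T P u

_⇒S_ : ∀ {L} → PredL L → PredL L → PredL L
(S ⇒S T) P u = ∀ (Q : RootedFinPoset) (h : PMor Q P) →
  S Q (restrict u h) → T Q (restrict u h)

-- Intersections, unions, ⊥ and ⊤ keep a common b-index, since ∼ₘ implies ∼ₙ for n ≤ m.
-- For S ⇒ T with b-indices n, the index n + 1 works: if u ∼ₙ₊₁ v and v ∘ g lies in S
-- at some stage R, the image in Q of the root of R is matched by a point p of P with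
-- u restricted to ↓p ∼ₙ v ∘ g. So u restricted to ↓p lies in S, hence in T because
-- u ∈ S ⇒ T, and transferring back along ∼ₙ puts v ∘ g in T.
module Submission where

open import Defs
open import Level using (lift)
open import Function using (id)
open import Data.Nat as ℕ using (ℕ; zero; suc; _⊔_; z≤n; s≤s)
open import Data.Nat.Properties using (m≤m⊔n; m≤n⊔m)
open import Data.Fin using (Fin; zero; suc)
open import Data.Fin.Properties using () renaming (_≟_ to _≟ᶠ_)
open import Data.List using (List; _∷_; lookup; filter; allFin)
open import Data.List.Relation.Unary.All as All using ()
open import Data.List.Relation.Unary.Any as Any using ()
open import Data.List.Relation.Unary.Any.Properties using (lookup-index)
open import Data.List.Relation.Unary.AllPairs using (_∷_)
open import Data.List.Relation.Unary.Unique.Propositional using (Unique)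
open import Data.List.Relation.Unary.Unique.Propositional.Properties using (allFin⁺; filter⁺)
open import Data.List.Membership.Propositional.Properties
  using (∈-lookup; ∈-allFin; ∈-filter⁺; ∈-filter⁻)
open import Data.Empty using (⊥-elim)
open import Data.Unit using (tt)
open import Data.Product using (Σ; ∃; _×_; _,_; proj₁; proj₂)
open import Data.Sum using (inj₁; inj₂)
open import Relation.Binary.PropositionalEquality
  using (_≡_; refl; sym; trans; cong; subst)
open import Relation.Binary.Structures using (IsDecPartialOrder)
open import Relation.Binary.Morphism using (IsOrderMonomorphism)
import Relation.Binary.Morphism.OrderMonomorphism as OrderMonomorphism

lookup-injective : {A : Set} {xs : List A} → Unique xs →
                   ∀ {i j} → lookup xs i ≡ lookup xs j → i ≡ j
lookup-injective (_  ∷ _) {zero}  {zero}  _  = refl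
lookup-injective (x≢ ∷ _) {zero}  {suc j} eq = ⊥-elim (All.lookup x≢ (∈-lookup j) eq)
lookup-injective (x≢ ∷ _) {suc i} {zero}  eq = ⊥-elim (All.lookup x≢ (∈-lookup i) (sym eq))
lookup-injective (_  ∷ u) {suc i} {suc j} eq = cong suc (lookup-injective u eq)

induced : (P : FinPoset) {m : ℕ} (e : Fin m → Carrier P) →
          (∀ {i j} → e i ≡ e j → i ≡ j) → FinPoset
induced P {m} e e-injective = record
  { size = m
  ; _≤_ = λ i j → e i P.≤ e j
  ; isDecPartialOrder = record
    { isPartialOrder = OrderMonomorphism.isPartialOrder e-monomorphism P.isPartialOrder
    ; _≟_ = _≟ᶠ_
    ; _≤?_ = λ i j → e i P.≤? e j
    }
  }
  where
  module P where
    open FinPoset P public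
    open IsDecPartialOrder isDecPartialOrder public

  e-monomorphism : IsOrderMonomorphism _≡_ _≡_ (λ i j → e i P.≤ e j) P._≤_ e
  e-monomorphism = record
    { isOrderHomomorphism = record { cong = cong e ; mono = id }
    ; injective = e-injective
    ; cancel = id
    }

≤-refl : (P : RootedFinPoset) {x : RootedFinPoset.Carrier P} → RootedFinPoset._≤_ P x x
≤-refl P = IsDecPartialOrder.refl (RootedFinPoset.isDecPartialOrder P)

module DownSet (P : RootedFinPoset) (p : RootedFinPoset.Carrier P) where
  open RootedFinPoset P hiding (Carrier)
  open IsDecPartialOrder isDecPartialOrder using (_≤?_) renaming (trans to ≤-trans)

  private
    elements : List (Fin size)
    elements = filter (_≤? p) (allFin size)

    element : Fin _ → Fin size
    element = lookup elements

    element-≤ : ∀ i → element i ≤ p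
    element-≤ i = proj₂ (∈-filter⁻ (_≤? p) {xs = allFin size} (∈-lookup i))

    element-surjective : ∀ {x} → x ≤ p → ∃ λ i → element i ≡ x
    element-surjective {x} x≤p =
      Any.index x∈ , sym (lookup-index x∈)
      where x∈ = ∈-filter⁺ (_≤? p) (∈-allFin x) x≤p

    element-injective : ∀ {i j} → element i ≡ element j → i ≡ j
    element-injective = lookup-injective (filter⁺ (_≤? p) (allFin⁺ size))

    top : ∃ λ i → element i ≡ p
    top = element-surjective (≤-refl P)

  ↓ : RootedFinPoset
  ↓ = record
    { poset = induced poset element element-injective
    ; root = proj₁ top
    ; root-greatest = λ i → subst (element i ≤_) (sym (proj₂ top)) (element-≤ i)
    }

  inclusion : PMor ↓ P
  inclusion = record
    { pfun = element
    ; pmono = id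
    ; open-map = λ i x x≤i →
        let (j , j≡x) = element-surjective (≤-trans x≤i (element-≤ i))
        in j , subst (_≤ element i) (sym j≡x) x≤i , j≡x
    }

  inclusion-root : pfun inclusion (RootedFinPoset.root ↓) ≡ p
  inclusion-root = proj₂ top

_∘ₚ_ : ∀ {R Q P} → PMor Q P → PMor R Q → PMor R P
h ∘ₚ g = record
  { pfun = λ r → pfun h (pfun g r)
  ; pmono = λ r≤r′ → pmono h (pmono g r≤r′)
  ; open-map = λ r p′ p′≤hgr →
      let (q′ , q′≤gr , hq′≡p′) = open-map h (pfun g r) p′ p′≤hgr
          (r′ , r′≤r , gr′≡q′) = open-map g r q′ q′≤gr
      in r′ , r′≤r , trans (cong (pfun h) gr′≡q′) hq′≡p′
  }

module _ {L : FinPoset} where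
  open FinPoset L using (_≤_)
  open IsDecPartialOrder (FinPoset.isDecPartialOrder L) using (antisym)
  open RootedFinPoset using (root; root-greatest)

  Bisim-value : ∀ n {P u p Q v q} → Bisim {L} n P u p Q v q → fun u p ≡ fun v q
  Bisim-value zero    u≡v = u≡v
  Bisim-value (suc n) {P} {u} {p} {Q} {v} {q} (forth , back) = antisym u≤v v≤u
    where
    u≤v : fun u p ≤ fun v q
    u≤v = let (q′ , q′≤q , b) = forth p (≤-refl P)
          in subst (_≤ fun v q) (sym (Bisim-value n b)) (mono v q′≤q)
    v≤u : fun v q ≤ fun u p
    v≤u = let (p′ , p′≤p , b) = back q (≤-refl Q)
          in subst (_≤ fun u p) (Bisim-value n b) (mono u p′≤p)

  Bisim-≤ : ∀ {m n} → m ℕ.≤ n → ∀ {P u p Q v q} →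
            Bisim {L} n P u p Q v q → Bisim {L} m P u p Q v q
  Bisim-≤ {n = n} z≤n b = Bisim-value n b
  Bisim-≤ (s≤s m≤n) (forth , back) =
    (λ p′ p′≤p → let (q′ , q′≤q , b) = forth p′ p′≤p in q′ , q′≤q , Bisim-≤ m≤n b) ,
    (λ q′ q′≤q → let (p′ , p′≤p , b) = back q′ q′≤q in p′ , p′≤p , Bisim-≤ m≤n b)

  Bisim-sym : ∀ n {P u p Q v q} → Bisim {L} n P u p Q v q → Bisim {L} n Q v q P u p
  Bisim-sym zero    u≡v = sym u≡v
  Bisim-sym (suc n) (forth , back) =
    (λ q′ q′≤q → let (p′ , p′≤p , b) = back q′ q′≤q in p′ , p′≤p , Bisim-sym n b) ,
    (λ p′ p′≤p → let (q′ , q′≤q , b) = forth p′ p′≤p in q′ , q′≤q , Bisim-sym n b)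

  Bisim-trans : ∀ n {P u p Q v q R w r} → Bisim {L} n P u p Q v q →
                Bisim {L} n Q v q R w r → Bisim {L} n P u p R w r
  Bisim-trans zero    u≡v v≡w = trans u≡v v≡w
  Bisim-trans (suc n) (forth , back) (forth′ , back′) =
    (λ p′ p′≤p → let (q′ , q′≤q , b) = forth p′ p′≤p
                     (r′ , r′≤r , c) = forth′ q′ q′≤q
                 in r′ , r′≤r , Bisim-trans n b c) ,
    (λ r′ r′≤r → let (q′ , q′≤q , c) = back′ r′ r′≤r
                     (p′ , p′≤p , b) = back q′ q′≤q
                 in p′ , p′≤p , Bisim-trans n b c)

  restrict-Bisim : ∀ n {R Q} (v : HL L Q) (g : PMor R Q) r →
                   Bisim {L} n R (restrict v g) r Q v (pfun g r)
  restrict-Bisim zero    v g r = refl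
  restrict-Bisim (suc n) v g r =
    (λ r′ r′≤r → pfun g r′ , pmono g r′≤r , restrict-Bisim n v g r′) ,
    (λ q′ q′≤gr → let (r′ , r′≤r , gr′≡q′) = open-map g r q′ q′≤gr
                  in r′ , r′≤r , subst (Bisim n _ _ r′ _ v) gr′≡q′ (restrict-Bisim n v g r′))

  HasBIndex-≤ : ∀ {S : PredL L} {m n} → m ℕ.≤ n → HasBIndex S m → HasBIndex S n
  HasBIndex-≤ m≤n S-index P Q u v u∈S u∼v = S-index P Q u v u∈S (Bisim-≤ m≤n u∼v)

  common-BIndex : ∀ {S T : PredL L} → Σ ℕ (HasBIndex S) → Σ ℕ (HasBIndex T) →
                  Σ ℕ λ k → HasBIndex S k × HasBIndex T k
  common-BIndex (m , S-index) (n , T-index) =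
    m ⊔ n , HasBIndex-≤ (m≤m⊔n m n) S-index , HasBIndex-≤ (m≤n⊔m m n) T-index

  ∩S-HasBIndex : ∀ {S T : PredL L} {n} → HasBIndex S n → HasBIndex T n → HasBIndex (S ∩S T) n
  ∩S-HasBIndex S-index T-index P Q u v (u∈S , u∈T) u∼v =
    S-index P Q u v u∈S u∼v , T-index P Q u v u∈T u∼v

  ∪S-HasBIndex : ∀ {S T : PredL L} {n} → HasBIndex S n → HasBIndex T n → HasBIndex (S ∪S T) n
  ∪S-HasBIndex S-index T-index P Q u v (inj₁ u∈S) u∼v = inj₁ (S-index P Q u v u∈S u∼v)
  ∪S-HasBIndex S-index T-index P Q u v (inj₂ u∈T) u∼v = inj₂ (T-index P Q u v u∈T u∼v)

  ⇒S-isSubpresheaf : ∀ {S T : PredL L} → IsSubpresheaf (S ⇒S T)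
  ⇒S-isSubpresheaf h u u∈S⇒T R g = u∈S⇒T R (h ∘ₚ g)

  ⇒S-HasBIndex : ∀ {S T : PredL L} {n} → HasBIndex S n → HasBIndex T n →
                 HasBIndex (S ⇒S T) (suc n)
  ⇒S-HasBIndex {S} {T} {n} S-index T-index P Q u v u∈S⇒T (_ , back) R g vg∈S =
    T-index ↓ R w vg (u∈S⇒T ↓ inclusion w∈S) w∼vg
    where
    vg = restrict v g
    p-match = back (pfun g (root R)) (root-greatest Q _)
    open DownSet P (proj₁ p-match)
    w = restrict u inclusion

    w∼vg : Bisim n ↓ w (root ↓) R vg (root R)
    w∼vg = Bisim-trans n
      (subst (Bisim n ↓ w (root ↓) P u) inclusion-root (restrict-Bisim n u inclusion (root ↓)))
      (Bisim-trans n (proj₂ (proj₂ p-match)) (Bisim-sym n (restrict-Bisim n v g (root R))))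

    w∈S : S ↓ w
    w∈S = S-index R ↓ vg w vg∈S (Bisim-sym n w∼vg)

  botS-In𝒮 : In𝒮 {L} botS
  botS-In𝒮 = (λ { _ _ (lift ()) }) , 0 , λ { _ _ _ _ (lift ()) _ }

  topS-In𝒮 : In𝒮 {L} topS
  topS-In𝒮 = (λ _ _ _ → lift tt) , 0 , λ _ _ _ _ _ _ → lift tt

  ∩S-In𝒮 : ∀ {S T : PredL L} → In𝒮 S → In𝒮 T → In𝒮 (S ∩S T)
  ∩S-In𝒮 (S-presheaf , S-index) (T-presheaf , T-index) =
    (λ h u (u∈S , u∈T) → S-presheaf h u u∈S , T-presheaf h u u∈T) ,
    (let (k , S-k , T-k) = common-BIndex S-index T-index in k , ∩S-HasBIndex S-k T-k)

  ∪S-In𝒮 : ∀ {S T : PredL L} → In𝒮 S → In𝒮 T → In𝒮 (S ∪S T)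
  ∪S-In𝒮 (S-presheaf , S-index) (T-presheaf , T-index) =
    (λ { h u (inj₁ u∈S) → inj₁ (S-presheaf h u u∈S)
       ; h u (inj₂ u∈T) → inj₂ (T-presheaf h u u∈T) }) ,
    (let (k , S-k , T-k) = common-BIndex S-index T-index in k , ∪S-HasBIndex S-k T-k)

  ⇒S-In𝒮 : ∀ {S T : PredL L} → In𝒮 S → In𝒮 T → In𝒮 (S ⇒S T)
  ⇒S-In𝒮 {S} {T} (_ , S-index) (_ , T-index) =
    ⇒S-isSubpresheaf {S} {T} ,
    (let (k , S-k , T-k) = common-BIndex S-index T-index in suc k , ⇒S-HasBIndex S-k T-k)

mainTheorem7 : (L : FinPoset) →
    In𝒮 {L} botS × In𝒮 {L} topS
    × ((S T : PredL L) → In𝒮 S → In𝒮 T →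
        In𝒮 (S ∩S T) × In𝒮 (S ∪S T) × In𝒮 (S ⇒S T))
mainTheorem7 L =
  botS-In𝒮 , topS-In𝒮 ,
  λ S T S∈𝒮 T∈𝒮 → ∩S-In𝒮 S∈𝒮 T∈𝒮 , ∪S-In𝒮 S∈𝒮 T∈𝒮 , ⇒S-In𝒮 S∈𝒮 T∈𝒮
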